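{- Let $(\mathfrak{h},[\cdot,\cdot],*)$ be a graded right Post-Lie algebra with $\mathfrak{h}_0=(0)$. Then for all $(n,m,k)\in\mathbb{N}^3$, $T(\mathfrak{h})^k_n*T(\mathfrak{h})_m\subseteq T(\mathfrak{h})^k_{n+m}$, where $*$ denotes the canonical extension of $*$ to $T(\mathfrak{h})$ described in the context.
   Context: A right Post-Lie algebra is a Lie algebra with bilinear $*$ satisfying $x*[y,z]=a(x,y,z)-a(x,z,y)$ and $[x,y]*z=[x*z,y]+[x,y*z]$, with $a(x,y,z)=(x*y)*z-x*(y*z)$. It is graded if $\mathfrak{h}=\bigoplus_{n\ge0}\mathfrak{h}_n$ with finite-dimensional $\mathfrak{h}_n$, $[\mathfrak{h}_i,\mathfrak{h}_j]\subseteq\mathfrak{h}_{i+j}$ and $\mathfrak{h}_i*\mathfrak{h}_j\subseteq\mathfrak{h}_{i+j}$. $T(\mathfrak{h})$ is the tensor algebra (concatenation product, coproduct making elements of $\mathfrak{h}$ primitive). The degree of a word $f_1\cdots f_k$ of homogeneous letters is $\sum\deg f_i$ (and $\deg 1=0$); $T(\mathfrak{h})_n$ is the span of words of degree $n$, $T(\mathfrak{h})^k=\mathfrak{h}^{\otimes k}$, $T(\mathfrak{h})^k_n=T(\mathfrak{h})^k\cap T(\mathfrak{h})_n$. Canonical extension: for a vector space $V$ with bilinear product $*$, $*$ extends uniquely to $T(V)\otimes T(V)\to T(V)$ so that for all $f,g,h\in T(V)$, $y\in V$ (Sweedler $\Delta(h)=h^{(1)}\otimes h^{(2)}$): $\varepsilon(f*g)=\varepsilon(f)\varepsilon(g)$;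 $\Delta(f*g)=\Delta(f)*\Delta(g)$; $f*1=f$; $1*f=\varepsilon(f)1$; $f*(gy)=(f*g)*y-f*(g*y)$; $(fg)*h=(f*h^{(1)})(g*h^{(2)})$; $(f*g)*h=f*((g*h^{(1)})h^{(2)})$. -}

module Defs where

open import Level using (Level; _⊔_) renaming (suc to lsuc)
open import Data.Nat using (ℕ) renaming (_+_ to _+ℕ_)
open import Data.List using (List; []; _∷_; [_]; _++_; length; zipWith; foldr)
open import Data.Nat.ListAction using (sum)
open import Data.List.Relation.Unary.All using (All)
open import Data.List.Relation.Unary.Unique.Propositional using (Unique)
open import Data.List.Relation.Binary.Pointwise using (Pointwise)
open import Data.Product using (Σ; _×_; _,_; proj₁; proj₂; ∃-syntax)
open import Relation.Binary.PropositionalEquality using (_≡_)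
open import Relation.Nullary using (¬_)
open import Algebra.Bundles using (CommutativeRing)
open import Algebra.Module.Bundles using (Module)

record Field (c ℓ : Level) : Set (lsuc (c ⊔ ℓ)) where
  field
    commutativeRing : CommutativeRing c ℓ
  open CommutativeRing commutativeRing public
  field
    1≉0     : ¬ (1# ≈ 0#)
    inverse : ∀ x → ¬ (x ≈ 0#) → ∃[ y ] (x * y ≈ 1#)

-- Graded right Post-Lie algebras over a field K.
--   h = ⊕_{n ≥ 0} h_n  with  Hom n x  meaning  x ∈ h_n.

record GradedPostLie {c ℓ : Level} (K : Field c ℓ) (m ℓm : Level)
       : Set (c ⊔ ℓ ⊔ lsuc (m ⊔ ℓm)) where
  open Field K
  field
    vectorSpace : Module commutativeRing m ℓm
  open Module vectorSpace public
  infixl 6 _-ᴹ_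
  _-ᴹ_ : Carrierᴹ → Carrierᴹ → Carrierᴹ
  x -ᴹ y = x +ᴹ (-ᴹ y)

  field
    ⟦_,_⟧      : Carrierᴹ → Carrierᴹ → Carrierᴹ
    br-cong    : ∀ {x x' y y'} → x ≈ᴹ x' → y ≈ᴹ y' → ⟦ x , y ⟧ ≈ᴹ ⟦ x' , y' ⟧
    br-+ˡ      : ∀ x y z → ⟦ x +ᴹ y , z ⟧ ≈ᴹ ⟦ x , z ⟧ +ᴹ ⟦ y , z ⟧
    br-+ʳ      : ∀ x y z → ⟦ x , y +ᴹ z ⟧ ≈ᴹ ⟦ x , y ⟧ +ᴹ ⟦ x , z ⟧
    br-*ˡ      : ∀ a x y → ⟦ a *ₗ x , y ⟧ ≈ᴹ a *ₗ ⟦ x , y ⟧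
    br-*ʳ      : ∀ a x y → ⟦ x , a *ₗ y ⟧ ≈ᴹ a *ₗ ⟦ x , y ⟧
    br-alt     : ∀ x → ⟦ x , x ⟧ ≈ᴹ 0ᴹ
    jacobi     : ∀ x y z →
                 ⟦ x , ⟦ y , z ⟧ ⟧ +ᴹ ⟦ y , ⟦ z , x ⟧ ⟧ +ᴹ ⟦ z , ⟦ x , y ⟧ ⟧ ≈ᴹ 0ᴹ

    _✶_        : Carrierᴹ → Carrierᴹ → Carrierᴹ
    ✶-cong     : ∀ {x x' y y'} → x ≈ᴹ x' → y ≈ᴹ y' → (x ✶ y) ≈ᴹ (x' ✶ y')
    ✶-+ˡ       : ∀ x y z → ((x +ᴹ y) ✶ z) ≈ᴹ (x ✶ z) +ᴹ (y ✶ z)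
    ✶-+ʳ       : ∀ x y z → (x ✶ (y +ᴹ z)) ≈ᴹ (x ✶ y) +ᴹ (x ✶ z)
    ✶-*ˡ       : ∀ a x y → ((a *ₗ x) ✶ y) ≈ᴹ a *ₗ (x ✶ y)
    ✶-*ʳ       : ∀ a x y → (x ✶ (a *ₗ y)) ≈ᴹ a *ₗ (x ✶ y)

  assoc : Carrierᴹ → Carrierᴹ → Carrierᴹ → Carrierᴹ
  assoc x y z = ((x ✶ y) ✶ z) -ᴹ (x ✶ (y ✶ z))

  field
    postLie₁   : ∀ x y z → (x ✶ ⟦ y , z ⟧) ≈ᴹ assoc x y z -ᴹ assoc x z y
    postLie₂   : ∀ x y z → (⟦ x , y ⟧ ✶ z) ≈ᴹ ⟦ x ✶ z , y ⟧ +ᴹ ⟦ x , y ✶ z ⟧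

    Hom        : ℕ → Carrierᴹ → Set ℓm
    Hom-resp   : ∀ {n x y} → x ≈ᴹ y → Hom n x → Hom n y
    Hom-0      : ∀ n → Hom n 0ᴹ
    Hom-+      : ∀ {n x y} → Hom n x → Hom n y → Hom n (x +ᴹ y)
    Hom-*      : ∀ {n} a {x} → Hom n x → Hom n (a *ₗ x)
    decompose  : ∀ x → ∃[ xs ] (All (λ p → Hom (proj₁ p) (proj₂ p)) xs
                                 × x ≈ᴹ foldr (λ p s → proj₂ p +ᴹ s) 0ᴹ xs)
    direct     : ∀ (xs : List (ℕ × Carrierᴹ))
                 → Unique (Data.List.map proj₁ xs)
                 → All (λ p → Hom (proj₁ p) (proj₂ p)) xs
                 → foldr (λ p s → proj₂ p +ᴹ s) 0ᴹ xs ≈ᴹ 0ᴹ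
                 → All (λ p → proj₂ p ≈ᴹ 0ᴹ) xs
    finDim     : ∀ n → ∃[ bs ] (All (Hom n) bs
                   × (∀ x → Hom n x → ∃[ cs ]
                        (x ≈ᴹ foldr _+ᴹ_ 0ᴹ (zipWith _*ₗ_ cs bs))))
    br-graded  : ∀ {i j x y} → Hom i x → Hom j y → Hom (i +ℕ j) ⟦ x , y ⟧
    ✶-graded   : ∀ {i j x y} → Hom i x → Hom j y → Hom (i +ℕ j) (x ✶ y)

-- The tensor algebra T(h): the free K-module on words of letters of h,
-- modulo multilinearity in each letter (this is ⊕_k h^{⊗k}), as a setoid.

module TensorAlgebra {c ℓ m ℓm : Level} {K : Field c ℓ}
                     (𝔥 : GradedPostLie K m ℓm) where
  open Field K
  open GradedPostLie 𝔥

  infixl 6 _⊕_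
  infixr 7 _·_
  infix 4 _~_

  data T : Set (c ⊔ m) where
    𝟘    : T
    word : List Carrierᴹ → T
    _⊕_  : T → T → T
    _·_  : Carrier → T → T
    ⊖_   : T → T

  data _~_ : T → T → Set (c ⊔ ℓ ⊔ m ⊔ ℓm) where
    ~-refl   : ∀ {s} → s ~ s
    ~-sym    : ∀ {s t} → s ~ t → t ~ s
    ~-trans  : ∀ {s t u} → s ~ t → t ~ u → s ~ u
    ⊕-cong   : ∀ {s s' t t'} → s ~ s' → t ~ t' → s ⊕ t ~ s' ⊕ t'
    ·-cong   : ∀ {a b s t} → a ≈ b → s ~ t → a · s ~ b · t
    ⊖-cong   : ∀ {s t} → s ~ t → ⊖ s ~ ⊖ t
    word-cong : ∀ {u v} → Pointwise _≈ᴹ_ u v → word u ~ word v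
    ⊕-assoc  : ∀ s t u → (s ⊕ t) ⊕ u ~ s ⊕ (t ⊕ u)
    ⊕-comm   : ∀ s t → s ⊕ t ~ t ⊕ s
    ⊕-idˡ    : ∀ s → 𝟘 ⊕ s ~ s
    ⊖-invʳ   : ∀ s → s ⊕ ⊖ s ~ 𝟘
    ·-distʳ  : ∀ a s t → a · (s ⊕ t) ~ a · s ⊕ a · t
    ·-distˡ  : ∀ a b s → (a + b) · s ~ a · s ⊕ b · s
    ·-assoc  : ∀ a b s → (a * b) · s ~ a · (b · s)
    ·-id     : ∀ s → 1# · s ~ s
    lin-+    : ∀ u x y v → word (u ++ (x +ᴹ y) ∷ v) ~ word (u ++ x ∷ v) ⊕ word (u ++ y ∷ v)
    lin-*    : ∀ u a x v → word (u ++ (a *ₗ x) ∷ v) ~ a · word (u ++ x ∷ v)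

  𝟙 : T
  𝟙 = word []

  ι : Carrierᴹ → T
  ι x = word [ x ]

  wmul : List Carrierᴹ → T → T
  wmul u 𝟘        = 𝟘
  wmul u (word v) = word (u ++ v)
  wmul u (s ⊕ t)  = wmul u s ⊕ wmul u t
  wmul u (a · s)  = a · wmul u s
  wmul u (⊖ s)    = ⊖ wmul u s

  infixl 7 _⊗_
  _⊗_ : T → T → T
  𝟘      ⊗ t = 𝟘
  word u ⊗ t = wmul u t
  (s ⊕ s') ⊗ t = s ⊗ t ⊕ s' ⊗ t
  (a · s) ⊗ t = a · (s ⊗ t)
  (⊖ s)  ⊗ t = ⊖ (s ⊗ t)

  ε : T → Carrier
  ε 𝟘            = 0#
  ε (word [])    = 1#
  ε (word (_ ∷ _)) = 0#
  ε (s ⊕ t)      = ε s + ε t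
  ε (a · s)      = a * ε s
  ε (⊖ s)        = - ε s

  data Span {p : Level} (P : List Carrierᴹ → Set p) : T → Set (c ⊔ ℓ ⊔ m ⊔ ℓm ⊔ p) where
    sp-gen  : ∀ {w} → P w → Span P (word w)
    sp-0    : Span P 𝟘
    sp-+    : ∀ {s t} → Span P s → Span P t → Span P (s ⊕ t)
    sp-*    : ∀ a {s} → Span P s → Span P (a · s)
    sp-⊖    : ∀ {s} → Span P s → Span P (⊖ s)
    sp-resp : ∀ {s t} → s ~ t → Span P s → Span P t

  HomWord : ℕ → ℕ → List Carrierᴹ → Set (m ⊔ ℓm)
  HomWord k n w = length w ≡ k × ∃[ ds ] (Pointwise Hom ds w × sum ds ≡ n)

  T^_₍_₎ : ℕ → ℕ → T → Set (c ⊔ ℓ ⊔ m ⊔ ℓm)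
  T^ k ₍ n ₎ = Span (HomWord k n)

  T₍_₎ : ℕ → T → Set (c ⊔ ℓ ⊔ m ⊔ ℓm)
  T₍ n ₎ = Span (λ w → ∃[ k ] HomWord k n w)

  -- The canonical extension of * to T(h) (characterised by its axioms;
  -- the axioms involving Δ are used only with a primitive argument y ∈ h,
  -- where Δ(y) = y ⊗ 1 + 1 ⊗ y).

  record CanonicalExtension : Set (c ⊔ ℓ ⊔ m ⊔ ℓm) where
    infixl 8 _⋆_
    field
      _⋆_      : T → T → T
      ⋆-cong   : ∀ {f f' g g'} → f ~ f' → g ~ g' → f ⋆ g ~ f' ⋆ g'
      ⋆-⊕ˡ     : ∀ f f' g → (f ⊕ f') ⋆ g ~ f ⋆ g ⊕ f' ⋆ g
      ⋆-⊕ʳ     : ∀ f g g' → f ⋆ (g ⊕ g') ~ f ⋆ g ⊕ f ⋆ g'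
      ⋆-·ˡ     : ∀ a f g → (a · f) ⋆ g ~ a · (f ⋆ g)
      ⋆-·ʳ     : ∀ a f g → f ⋆ (a · g) ~ a · (f ⋆ g)
      ⋆-ext    : ∀ x y → ι x ⋆ ι y ~ ι (x ✶ y)
      ⋆-ε      : ∀ f g → ε (f ⋆ g) ≈ ε f * ε g
      ⋆-unitʳ  : ∀ f → f ⋆ 𝟙 ~ f
      ⋆-unitˡ  : ∀ f → 𝟙 ⋆ f ~ ε f · 𝟙
      ⋆-rec    : ∀ f g y → f ⋆ (g ⊗ ι y) ~ (f ⋆ g) ⋆ ι y ⊕ ⊖ (f ⋆ (g ⋆ ι y))
      -- (fg)*y = (f*y^(1))(g*y^(2)) = (f*y) g + f (g*y)   for y ∈ h
      ⋆-leibniz : ∀ f g y → (f ⊗ g) ⋆ ι y ~ (f ⋆ ι y) ⊗ g ⊕ f ⊗ (g ⋆ ι y)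
      -- (f*g)*y = f*((g*y^(1))y^(2)) = f*(g*y) + f*(gy)   for y ∈ h
      ⋆-assoc  : ∀ f g y → (f ⋆ g) ⋆ ι y ~ f ⋆ (g ⋆ ι y) ⊕ f ⋆ (g ⊗ ι y)

-- The canonical extension satisfies f * 1 = f and f * (u y) = (f * u) * y − f * (u * y)
-- for a letter y, so by induction on the length of the right-hand word it suffices to know
-- that multiplying by a homogeneous letter y ∈ 𝔥ₑ maps T(𝔥)^k_n into T(𝔥)^k_{n+e}.  That holds
-- because y acts on words as a derivation: (f₁⋯f_k) * y = Σᵢ f₁⋯(fᵢ * y)⋯f_k, which
-- preserves the length of a word and, * being graded, raises its degree by e.
module Submission where

open import Defs
open import Level using (Level; _⊔_)
open import Data.Nat using (ℕ; _+_; zero; suc)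
open import Data.Nat.Properties using (+-assoc; +-identityʳ; +-commutativeSemigroup)
open import Algebra.Properties.CommutativeSemigroup +-commutativeSemigroup using (xy∙z≈xz∙y)
open import Data.Nat.ListAction using (sum)
open import Data.Nat.ListAction.Properties using (sum-++)
open import Data.List using (List; []; _∷_; [_]; _++_; length)
open import Data.List.Properties using (++-assoc; length-++)
open import Data.List.Relation.Binary.Pointwise as Pointwise using ([]; _∷_)
open import Data.Product using (_,_)
open import Relation.Binary.PropositionalEquality using (_≡_; refl; sym; trans; cong; subst)

module TensorAlgebraProperties {c ℓ m ℓm : Level} {K : Field c ℓ} (𝔥 : GradedPostLie K m ℓm) where
  private module K = Field K
  open GradedPostLie 𝔥
  open TensorAlgebra 𝔥

  ⊕-identityʳ : ∀ s → s ⊕ 𝟘 ~ s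
  ⊕-identityʳ s = ~-trans (⊕-comm s 𝟘) (⊕-idˡ s)

  ⊖-inverseˡ : ∀ s → ⊖ s ⊕ s ~ 𝟘
  ⊖-inverseˡ s = ~-trans (⊕-comm (⊖ s) s) (⊖-invʳ s)

  ⊕-transposeˡ : ∀ {s t u} → s ⊕ t ~ u → t ~ ⊖ s ⊕ u
  ⊕-transposeˡ {s} {t} p =
    ~-trans (~-sym (⊕-idˡ t)) (~-trans (⊕-cong (~-sym (⊖-inverseˡ s)) ~-refl)
      (~-trans (⊕-assoc (⊖ s) s t) (⊕-cong ~-refl p)))

  ·-zeroˡ : ∀ s → K.0# · s ~ 𝟘
  ·-zeroˡ s = ~-trans (⊕-transposeˡ 0s⊕0s~0s) (⊖-inverseˡ (K.0# · s))
    where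
    0s⊕0s~0s : K.0# · s ⊕ K.0# · s ~ K.0# · s
    0s⊕0s~0s = ~-trans (~-sym (·-distˡ K.0# K.0# s)) (·-cong (K.+-identityʳ K.0#) ~-refl)

  -1·s~⊖s : ∀ s → (K.- K.1#) · s ~ ⊖ s
  -1·s~⊖s s = ~-trans (⊕-transposeˡ s⊕-1·s~0) (⊕-identityʳ (⊖ s))
    where
    s⊕-1·s~0 : s ⊕ (K.- K.1#) · s ~ 𝟘
    s⊕-1·s~0 = ~-trans (⊕-cong (~-sym (·-id s)) ~-refl)
      (~-trans (~-sym (·-distˡ K.1# (K.- K.1#) s))
        (~-trans (·-cong (K.-‿inverseʳ K.1#) ~-refl) (·-zeroˡ s)))

  word-≡ : ∀ {u v} → u ≡ v → word u ~ word v
  word-≡ refl = ~-refl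

  wmul-cong : ∀ u {s t} → s ~ t → wmul u s ~ wmul u t
  wmul-cong u ~-refl = ~-refl
  wmul-cong u (~-sym p) = ~-sym (wmul-cong u p)
  wmul-cong u (~-trans p q) = ~-trans (wmul-cong u p) (wmul-cong u q)
  wmul-cong u (⊕-cong p q) = ⊕-cong (wmul-cong u p) (wmul-cong u q)
  wmul-cong u (·-cong a≈b p) = ·-cong a≈b (wmul-cong u p)
  wmul-cong u (⊖-cong p) = ⊖-cong (wmul-cong u p)
  wmul-cong u (word-cong p) = word-cong (Pointwise.++⁺ (Pointwise.refl ≈ᴹ-refl) p)
  wmul-cong u (⊕-assoc s t v) = ⊕-assoc _ _ _
  wmul-cong u (⊕-comm s t) = ⊕-comm _ _
  wmul-cong u (⊕-idˡ s) = ⊕-idˡ _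
  wmul-cong u (⊖-invʳ s) = ⊖-invʳ _
  wmul-cong u (·-distʳ a s t) = ·-distʳ _ _ _
  wmul-cong u (·-distˡ a b s) = ·-distˡ _ _ _
  wmul-cong u (·-assoc a b s) = ·-assoc _ _ _
  wmul-cong u (·-id s) = ·-id _
  wmul-cong u (lin-+ v x y w) =
    ~-trans (word-≡ (sym (++-assoc u v _))) (~-trans (lin-+ (u ++ v) x y w)
      (⊕-cong (word-≡ (++-assoc u v _)) (word-≡ (++-assoc u v _))))
  wmul-cong u (lin-* v a x w) =
    ~-trans (word-≡ (sym (++-assoc u v _))) (~-trans (lin-* (u ++ v) a x w)
      (·-cong K.refl (word-≡ (++-assoc u v _))))

  ⊗-word-congˡ : ∀ v {s t} → s ~ t → s ⊗ word v ~ t ⊗ word v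
  ⊗-word-congˡ v ~-refl = ~-refl
  ⊗-word-congˡ v (~-sym p) = ~-sym (⊗-word-congˡ v p)
  ⊗-word-congˡ v (~-trans p q) = ~-trans (⊗-word-congˡ v p) (⊗-word-congˡ v q)
  ⊗-word-congˡ v (⊕-cong p q) = ⊕-cong (⊗-word-congˡ v p) (⊗-word-congˡ v q)
  ⊗-word-congˡ v (·-cong a≈b p) = ·-cong a≈b (⊗-word-congˡ v p)
  ⊗-word-congˡ v (⊖-cong p) = ⊖-cong (⊗-word-congˡ v p)
  ⊗-word-congˡ v (word-cong p) = word-cong (Pointwise.++⁺ p (Pointwise.refl ≈ᴹ-refl))
  ⊗-word-congˡ v (⊕-assoc s t u) = ⊕-assoc _ _ _
  ⊗-word-congˡ v (⊕-comm s t) = ⊕-comm _ _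
  ⊗-word-congˡ v (⊕-idˡ s) = ⊕-idˡ _
  ⊗-word-congˡ v (⊖-invʳ s) = ⊖-invʳ _
  ⊗-word-congˡ v (·-distʳ a s t) = ·-distʳ _ _ _
  ⊗-word-congˡ v (·-distˡ a b s) = ·-distˡ _ _ _
  ⊗-word-congˡ v (·-assoc a b s) = ·-assoc _ _ _
  ⊗-word-congˡ v (·-id s) = ·-id _
  ⊗-word-congˡ v (lin-+ u x y w) =
    ~-trans (word-≡ (++-assoc u _ v)) (~-trans (lin-+ u x y (w ++ v))
      (⊕-cong (word-≡ (sym (++-assoc u _ v))) (word-≡ (sym (++-assoc u _ v)))))
  ⊗-word-congˡ v (lin-* u a x w) =
    ~-trans (word-≡ (++-assoc u _ v)) (~-trans (lin-* u a x (w ++ v))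
      (·-cong K.refl (word-≡ (sym (++-assoc u _ v)))))

  HomWord-++ : ∀ {j k d n u v} → HomWord j d u → HomWord k n v → HomWord (j + k) (d + n) (u ++ v)
  HomWord-++ {u = u} (refl , ds , hs , refl) (refl , es , gs , refl) =
    length-++ u , ds ++ es , Pointwise.++⁺ hs gs , sum-++ ds es

  T^-cast : ∀ {k n n' s} → n ≡ n' → T^ k ₍ n ₎ s → T^ k ₍ n' ₎ s
  T^-cast refl hs = hs

  wmul-T^ : ∀ {j k d n u t} → HomWord j d u → T^ k ₍ n ₎ t → T^ (j + k) ₍ d + n ₎ (wmul u t)
  wmul-T^ hu (sp-gen hw) = sp-gen (HomWord-++ hu hw)
  wmul-T^ hu sp-0 = sp-0
  wmul-T^ hu (sp-+ p q) = sp-+ (wmul-T^ hu p) (wmul-T^ hu q)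
  wmul-T^ hu (sp-* a p) = sp-* a (wmul-T^ hu p)
  wmul-T^ hu (sp-⊖ p) = sp-⊖ (wmul-T^ hu p)
  wmul-T^ {u = u} hu (sp-resp s~t p) = sp-resp (wmul-cong u s~t) (wmul-T^ hu p)

  data HomWordSnoc (j : ℕ) : ℕ → List Carrierᴹ → Set (m ⊔ ℓm) where
    _∷ʳ_ : ∀ {d e u y} → HomWord j d u → Hom e y → HomWordSnoc j (d + e) (u ++ [ y ])

  HomWordSnoc-cons : ∀ {j d n x w} → Hom d x → HomWordSnoc j n w → HomWordSnoc (suc j) (d + n) (x ∷ w)
  HomWordSnoc-cons {j} {d} {x = x} hx (_∷ʳ_ {d'} {e} {u} {y} (refl , ds , hs , refl) hy) =
    subst (λ n → HomWordSnoc (suc j) n (x ∷ u ++ [ y ])) (+-assoc d d' e)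
      ((refl , d ∷ ds , hx ∷ hs , refl) ∷ʳ hy)

  HomWord-unsnoc : ∀ {j n} w → HomWord (suc j) n w → HomWordSnoc j n w
  HomWord-unsnoc (x ∷ []) (refl , e ∷ [] , hx ∷ [] , refl) =
    subst (λ n → HomWordSnoc 0 n [ x ]) (sym (+-identityʳ e)) ((refl , [] , [] , refl) ∷ʳ hx)
  HomWord-unsnoc (x ∷ x' ∷ w) (refl , d ∷ ds , hx ∷ hs , refl) =
    HomWordSnoc-cons hx (HomWord-unsnoc (x' ∷ w) (refl , ds , hs , refl))

module CanonicalExtensionProperties {c ℓ m ℓm : Level} {K : Field c ℓ} {𝔥 : GradedPostLie K m ℓm}
  (E : TensorAlgebra.CanonicalExtension 𝔥) where
  private module K = Field K
  open GradedPostLie 𝔥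
  open TensorAlgebra 𝔥
  open CanonicalExtension E
  open TensorAlgebraProperties 𝔥

  ⋆-zeroˡ : ∀ g → 𝟘 ⋆ g ~ 𝟘
  ⋆-zeroˡ g = ~-trans (⋆-cong (~-sym (·-zeroˡ 𝟘)) ~-refl) (~-trans (⋆-·ˡ K.0# 𝟘 g) (·-zeroˡ _))

  ⋆-zeroʳ : ∀ f → f ⋆ 𝟘 ~ 𝟘
  ⋆-zeroʳ f = ~-trans (⋆-cong ~-refl (~-sym (·-zeroˡ 𝟘))) (~-trans (⋆-·ʳ K.0# f 𝟘) (·-zeroˡ _))

  ⋆-⊖ˡ : ∀ f g → ⊖ f ⋆ g ~ ⊖ (f ⋆ g)
  ⋆-⊖ˡ f g = ~-trans (⋆-cong (~-sym (-1·s~⊖s f)) ~-refl) (~-trans (⋆-·ˡ _ f g) (-1·s~⊖s _))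

  ⋆-⊖ʳ : ∀ f g → f ⋆ ⊖ g ~ ⊖ (f ⋆ g)
  ⋆-⊖ʳ f g = ~-trans (⋆-cong ~-refl (~-sym (-1·s~⊖s g))) (~-trans (⋆-·ʳ _ f g) (-1·s~⊖s _))

  module _ {p q : Level} {P : List Carrierᴹ → Set p} {Q : List Carrierᴹ → Set q} where

    ⋆-Spanˡ : ∀ {f g} → (∀ {w} → P w → Span Q (word w ⋆ g)) → Span P f → Span Q (f ⋆ g)
    ⋆-Spanˡ onWords (sp-gen pw) = onWords pw
    ⋆-Spanˡ onWords sp-0 = sp-resp (~-sym (⋆-zeroˡ _)) sp-0
    ⋆-Spanˡ onWords (sp-+ p q) = sp-resp (~-sym (⋆-⊕ˡ _ _ _)) 
      (sp-+ (⋆-Spanˡ onWords p) (⋆-Spanˡ onWords q))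
    ⋆-Spanˡ onWords (sp-* a p) = sp-resp (~-sym (⋆-·ˡ _ _ _)) (sp-* a (⋆-Spanˡ onWords p))
    ⋆-Spanˡ onWords (sp-⊖ p) = sp-resp (~-sym (⋆-⊖ˡ _ _)) (sp-⊖ (⋆-Spanˡ onWords p))
    ⋆-Spanˡ onWords (sp-resp f~f' p) = sp-resp (⋆-cong f~f' ~-refl) (⋆-Spanˡ onWords p)

    ⋆-Spanʳ : ∀ {f g} → (∀ {w} → P w → Span Q (f ⋆ word w)) → Span P g → Span Q (f ⋆ g)
    ⋆-Spanʳ onWords (sp-gen pw) = onWords pw
    ⋆-Spanʳ onWords sp-0 = sp-resp (~-sym (⋆-zeroʳ _)) sp-0
    ⋆-Spanʳ onWords (sp-+ p q) = sp-resp (~-sym (⋆-⊕ʳ _ _ _)) 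
      (sp-+ (⋆-Spanʳ onWords p) (⋆-Spanʳ onWords q))
    ⋆-Spanʳ onWords (sp-* a p) = sp-resp (~-sym (⋆-·ʳ _ _ _)) (sp-* a (⋆-Spanʳ onWords p))
    ⋆-Spanʳ onWords (sp-⊖ p) = sp-resp (~-sym (⋆-⊖ʳ _ _)) (sp-⊖ (⋆-Spanʳ onWords p))
    ⋆-Spanʳ onWords (sp-resp g~g' p) = sp-resp (⋆-cong ~-refl g~g') (⋆-Spanʳ onWords p)

  word⋆ι-T^ : ∀ {k n e y} w → HomWord k n w → Hom e y → T^ k ₍ n + e ₎ (word w ⋆ ι y)
  word⋆ι-T^ {y = y} [] (refl , [] , [] , refl) hy =
    sp-resp (~-sym (~-trans (⋆-unitˡ (ι y)) (·-zeroˡ 𝟙))) sp-0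
  word⋆ι-T^ {e = e} {y} (x ∷ u) (refl , d ∷ ds , hx ∷ hs , refl) hy =
    sp-resp (~-sym (⋆-leibniz (ι x) (word u) y)) (sp-+ xy·u∈T^ x·uy∈T^)
    where
    xy·u∈T^ : T^ suc (length u) ₍ d + sum ds + e ₎ ((ι x ⋆ ι y) ⊗ word u)
    xy·u∈T^ = sp-resp (~-sym (⊗-word-congˡ u (⋆-ext x y)))
      (sp-gen (refl , d + e ∷ ds , ✶-graded hx hy ∷ hs , xy∙z≈xz∙y d e (sum ds)))
    x·uy∈T^ : T^ suc (length u) ₍ d + sum ds + e ₎ (ι x ⊗ (word u ⋆ ι y))
    x·uy∈T^ =
      T^-cast (trans (cong (_+ (sum ds + e)) (+-identityʳ d)) (sym (+-assoc d (sum ds) e)))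
        (wmul-T^ (refl , [ d ] , hx ∷ [] , refl) (word⋆ι-T^ u (refl , ds , hs , refl) hy))

  T^⋆ι : ∀ {k n e s y} → T^ k ₍ n ₎ s → Hom e y → T^ k ₍ n + e ₎ (s ⋆ ι y)
  T^⋆ι hs hy = ⋆-Spanˡ (λ {w} hw → word⋆ι-T^ w hw hy) hs

  T^⋆word : ∀ j {k n d f} w → T^ k ₍ n ₎ f → HomWord j d w → T^ k ₍ n + d ₎ (f ⋆ word w)
  T^⋆word zero {n = n} [] hf (refl , [] , [] , refl) =
    T^-cast (sym (+-identityʳ n)) (sp-resp (~-sym (⋆-unitʳ _)) hf)
  T^⋆word (suc j) {k} {n} {f = f} w hf hw = T^⋆snoc (HomWord-unsnoc w hw)
    where
    T^⋆snoc : ∀ {d v} → HomWordSnoc j d v → T^ k ₍ n + d ₎ (f ⋆ word v)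
    T^⋆snoc (_∷ʳ_ {d} {e} {u} {y} hu hy) =
      sp-resp (~-sym (⋆-rec f (word u) y))
        (sp-+ (T^-cast (+-assoc n d e) (T^⋆ι (T^⋆word j u hf hu) hy))
              (sp-⊖ (⋆-Spanʳ (λ {v} hv → T^⋆word j v hf hv) (word⋆ι-T^ u hu hy))))

  T^⋆T : ∀ {k n m f g} → T^ k ₍ n ₎ f → T₍ m ₎ g → T^ k ₍ n + m ₎ (f ⋆ g)
  T^⋆T hf hg = ⋆-Spanʳ (λ {w} (j , hw) → T^⋆word j w hf hw) hg

mainTheorem12 : ∀ {c ℓ m ℓm : Level} (K : Field c ℓ) (𝔥 : GradedPostLie K m ℓm)
    → (∀ x → GradedPostLie.Hom 𝔥 0 x → GradedPostLie._≈ᴹ_ 𝔥 x (GradedPostLie.0ᴹ 𝔥))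
    → (E : TensorAlgebra.CanonicalExtension 𝔥)
    → ∀ (n m k : ℕ) (f g : TensorAlgebra.T 𝔥)
    → TensorAlgebra.T^_₍_₎ 𝔥 k n f
    → TensorAlgebra.T₍_₎ 𝔥 m g
    → TensorAlgebra.T^_₍_₎ 𝔥 k (n + m) (TensorAlgebra.CanonicalExtension._⋆_ E f g)
mainTheorem12 K 𝔥 _ E n m k f g = CanonicalExtensionProperties.T^⋆T E
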